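{- Let $k\in\omega\setminus\{0,1\}$, let $\psi$ be a bounded complexity measure and let $A$ be a nontrivial closed class of decision tables from $\mathcal{M}_k^{\infty}$. Then the function $\mathcal{H}^{\infty}_{\psi,A}$ is everywhere defined if and only if the function $L_{\psi,A}$ is everywhere defined.
   Context: Let $\omega=\{0,1,2,\ldots\}$, let $\mathcal{P}(\omega)$ be the set of nonempty finite subsets of $\omega$, and for $k\in\omega\setminus\{0,1\}$ let $E_k=\{0,\ldots,k-1\}$. Let $P=\{f_i:i\in\omega\}$ be a set of attributes ($f_i\neq f_j$ iff $i\neq j$). $\mathcal{M}_k^{\infty}$ is the set of rectangular tables filled with numbers from $E_k$ whose rows are pairwise different, each row labeled with a set from $\mathcal{P}(\omega)$ (its set of decisions), and whose columns are labeled with pairwise different attributes from $P$; tables with no rows, all denoted $\Lambda$, also belong to $\mathcal{M}_k^{\infty}$. For $T\in\mathcal{M}_k^\infty$: $\Delta(T)$ is its set of rows, $\operatorname{At}(T)$ its set of column attributes, $\Pi(T)$ the intersection of the decision sets of all its rows (common decisions). For nonempty $T$, $\Omega_k(T)$ is the set of finite words (including the empty word $\lambda$) over the alphabet $\{(f_i,\delta):f_i\in\operatorname{At}(T),\delta\in E_k\}$; for $\alpha=(f_{i_1},\delta_1)\cdots(f_{i_m},\delta_m)$, $T\alpha$ is the subtable of rows having $\delta_1,\ldots,\delta_m$ in the columns labeled $f_{i_1},\ldots,f_{i_m}$ respectively ($T\lambda=T$). Operations: for $D\subseteq\operatorname{At}(T)$, $I(D,T)$ is obtained by deleting the columns labeled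 by attributes in $D$ and, in each group of rows equal on the remaining columns, keeping only the first one (with its decision set); for $\nu:E_k^{|\operatorname{At}(T)|}\to\mathcal{P}(\omega)$, $J(\nu,T)$ is obtained by replacing the decision set of each row $\bar\delta$ by $\nu(\bar\delta)$. $[T]=\{J(\nu,I(D,T)):D\subseteq\operatorname{At}(T),\nu:E_k^{|\operatorname{At}(T)\setminus D|}\to\mathcal{P}(\omega)\}$ and $[A]=\bigcup_{T\in A}[T]$; $A$ is a closed class if $[A]=A$, nontrivial if it contains a nonempty table. Decision trees: a $k$-decision tree is a finite directed rooted tree with at least two nodes, where the root and edges leaving it are unlabeled, terminal nodes are labeled with decisions from $\omega$, and every other node is labeled with an attribute from $P$, each edge leaving it labeled with a number from $E_k$. $\operatorname{At}(\Gamma)$ is the set of attributes labeling its nodes. For a complete path $\tau=v_1,d_1,\ldots,v_m,d_m,v_{m+1}$ (root to a terminal node), $\pi(\tau)=\lambda$ if $m=1$, otherwise $\pi(\tau)=(f_{i_2},\delta_2)\cdots(f_{i_m},\delta_m)$ where $v_j$ is labeled $f_{i_j}$ and $d_j$ is labeled $\delta_j$; $T(\tau)=T\pi(\tau)$. For nonempty $T$, a nondeterministic decision tree for $T$ is a $k$-decision tree $\Gamma$ with $\operatorname{At}(\Gamma)\subseteq\operatorname{At}(T)$ such that each row of $T$ belongs to $T(\tau)$ for some complete path $\tau$, and for each complete path $\tau$ either $T(\tau)=\Lambda$ or the decision at its terminal node lies in $\Pi(T(\tau))$. A deterministic decision tree for $T$ is a nondeterministic one in which exactly one edge leaves the root and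 edges leaving any other nonterminal node have pairwise different labels. Complexity measures: $P^*$ is the set of finite words over $P$ (including $\lambda$). A partially bounded complexity measure is $\psi:P^*\to\omega$ with: $\psi(\alpha)=0$ iff $\alpha=\lambda$; $\psi$ invariant under permutation of letters; $\psi(\alpha_1)\le\psi(\alpha_1\alpha_2)$; $\psi(\alpha_1\alpha_2)\le\psi(\alpha_1)+\psi(\alpha_2)$. It is bounded if also $\psi(\alpha)\ge|\alpha|$ for all $\alpha$. Extend $\psi$ to words over pairs by $\psi((f_{i_1},\delta_1)\cdots(f_{i_m},\delta_m))=\psi(f_{i_1}\cdots f_{i_m})$, $\psi(\lambda)=0$, and to trees by $\psi(\Gamma)=\max_\tau\psi(\pi(\tau))$ over complete paths. For nonempty $T$, $\psi^d(T)$ ($\psi^a(T)$) is the minimum of $\psi(\Gamma)$ over deterministic (nondeterministic) decision trees for $T$; $\psi^d(\Lambda)=\psi^a(\Lambda)=0$. Covers: for nonempty $T$ and $n\in\omega$, a $(\psi,n)$-cover of $T$ is a finite $U\subseteq\{\alpha\in\Omega_k(T):\psi(\alpha)\le n\}$ with $\bigcup_{\alpha\in U}\Delta(T\alpha)=\Delta(T)$; it is irreducible if no proper subset is a $(\psi,n)$-cover. $l_\psi(T,n)$ is the maximum cardinality of an irreducible $(\psi,n)$-cover of $T$; $l_\psi(\Lambda,n)=0$. Functions: $\mathcal{H}^{\infty}_{\psi,A}(n)$ is undefined if $\{\psi^d(T):T\in A,\psi^a(T)\le n\}$ is infinite and equals its maximum otherwise; $L_{\psi,A}(n)$ is undefined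 if $\{l_\psi(T,n):T\in A\}$ is infinite and equals its maximum otherwise. -}

module Defs where

open import Data.Nat using (ℕ; zero; suc; _≤_; _⊔_; _≡ᵇ_)
open import Data.Bool using (Bool; true; false; if_then_else_; _∧_; not)
open import Data.Fin using (Fin)
import Data.Fin as Fin
open import Data.Maybe using (Maybe; just; nothing)
open import Data.List using (List; []; _∷_; _++_; map; filterᵇ; deduplicate; foldr; length; concatMap)
open import Data.Bool.ListAction using (any; all)
open import Data.List.NonEmpty using (List⁺; _∷_; toList)
import Data.List.NonEmpty as L⁺
open import Data.List.Properties using (≡-dec)
open import Data.List.Relation.Unary.All using (All)
open import Data.List.Relation.Unary.Any using (Any)
open import Data.List.Relation.Unary.AllPairs using (AllPairs)
open import Data.List.Relation.Unary.Unique.Propositional using (Unique)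
open import Data.List.Membership.Propositional using (_∈_; _∉_)
open import Data.List.Relation.Binary.Permutation.Propositional using (_↭_)
open import Data.Product using (_×_; _,_; proj₁; proj₂; Σ; ∃; ∃-syntax)
open import Data.Sum using (_⊎_)
open import Relation.Binary.PropositionalEquality using (_≡_; _≢_)
open import Relation.Nullary using (¬_; does)

-- Attributes f_i are represented by their index i : ℕ.
-- Values are elements of E_k = Fin k.
-- A finite nonempty set of decisions is represented by a nonempty List ℕ
-- (only membership in it is ever used).

-- A row: its tuple of values (one per column, in column order) and its
-- decision set.
Row : ℕ → Set
Row k = List (Fin k) × List ℕ

record Table (k : ℕ) : Set where
  constructor mkTable
  field
    attrs : List ℕ
    rows  : List (Row k)
open Table public

-- Well-formedness: membership in M_k^∞.
record WF {k : ℕ} (T : Table k) : Set where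
  field
    attrsDistinct : Unique (attrs T)
    rowsLength    : All (λ r → length (proj₁ r) ≡ length (attrs T)) (rows T)
    rowsDistinct  : AllPairs (λ r s → proj₁ r ≢ proj₁ s) (rows T)
    decsNonempty  : All (λ r → proj₂ r ≢ []) (rows T)

keepCols : ∀ {k} → List ℕ → List ℕ → List (Fin k) → List (Fin k)
keepCols D [] vs = []
keepCols D (a ∷ as) [] = []
keepCols D (a ∷ as) (v ∷ vs) =
  if any (λ d → d ≡ᵇ a) D then keepCols D as vs else v ∷ keepCols D as vs

I : ∀ {k} → List ℕ → Table k → Table k
I {k} D T = mkTable
  (filterᵇ (λ a → not (any (λ d → d ≡ᵇ a) D)) (attrs T))
  (deduplicate (λ r s → ≡-dec Fin._≟_ (proj₁ r) (proj₁ s))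
    (map (λ r → keepCols D (attrs T) (proj₁ r) , proj₂ r) (rows T)))

J : ∀ {k} → (List (Fin k) → List ℕ) → Table k → Table k
J ν T = mkTable (attrs T) (map (λ r → proj₁ r , ν (proj₁ r)) (rows T))

InClosure : ∀ {k} → (Table k → Set) → Table k → Set
InClosure {k} A T' =
  ∃[ T ] (A T × ∃[ D ] (All (_∈ attrs T) D ×
    ∃[ ν ] ((∀ (v : List (Fin k)) → ν v ≢ []) × T' ≡ J ν (I D T))))

IsClassOfTables : ∀ {k} → (Table k → Set) → Set
IsClassOfTables A = ∀ T → A T → WF T

Closed : ∀ {k} → (Table k → Set) → Set
Closed A = ∀ T → (InClosure A T → A T) × (A T → InClosure A T)

Nontrivial : ∀ {k} → (Table k → Set) → Set
Nontrivial A = ∃[ T ] (A T × rows T ≢ [])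

Word : ℕ → Set
Word k = List (ℕ × Fin k)

valueAt : ∀ {k} → List ℕ → List (Fin k) → ℕ → Maybe (Fin k)
valueAt [] vs f = nothing
valueAt (a ∷ as) [] f = nothing
valueAt (a ∷ as) (v ∷ vs) f = if a ≡ᵇ f then just v else valueAt as vs f

satLetter : ∀ {k} → List ℕ → List (Fin k) → ℕ × Fin k → Bool
satLetter as vs (f , δ) with valueAt as vs f
... | just v  = does (v Fin.≟ δ)
... | nothing = false

sat : ∀ {k} → List ℕ → Row k → Word k → Bool
sat as r α = all (satLetter as (proj₁ r)) α

sub : ∀ {k} → Table k → Word k → Table k
sub T α = mkTable (attrs T) (filterᵇ (λ r → sat (attrs T) r α) (rows T))

InΩ : ∀ {k} → Table k → Word k → Set
InΩ T α = All (λ p → proj₁ p ∈ attrs T) α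

InΠ : ∀ {k} → ℕ → Table k → Set
InΠ d T = All (λ r → d ∈ proj₂ r) (rows T)

data Node (k : ℕ) : Set where
  leaf : ℕ → Node k
  test : ℕ → List⁺ (Fin k × Node k) → Node k

-- the root is unlabelled, with a nonempty list of unlabelled edges
Tree : ℕ → Set
Tree k = List⁺ (Node k)

-- complete paths, recorded as (π(τ), decision at terminal node)
Path : ℕ → Set
Path k = Word k × ℕ

mutual
  pathsN : ∀ {k} → Node k → List (Path k)
  pathsN (leaf d) = (([] , d) ∷ [])
  pathsN (test f (e ∷ es)) = pathsE f e ++ pathsEs f es

  pathsE : ∀ {k} → ℕ → Fin k × Node k → List (Path k)
  pathsE f (δ , n) = map (λ p → ((f , δ) ∷ proj₁ p) , proj₂ p) (pathsN n)

  pathsEs : ∀ {k} → ℕ → List (Fin k × Node k) → List (Path k)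
  pathsEs f [] = []
  pathsEs f (e ∷ es) = pathsE f e ++ pathsEs f es

paths : ∀ {k} → Tree k → List (Path k)
paths Γ = concatMap pathsN (toList Γ)

data AttrsIn {k : ℕ} (S : List ℕ) : Node k → Set where
  leafA : ∀ {d} → AttrsIn S (leaf d)
  testA : ∀ {f es} → f ∈ S → All (λ e → AttrsIn S (proj₂ e)) (toList es) →
          AttrsIn S (test f es)

data DetN {k : ℕ} : Node k → Set where
  leafD : ∀ {d} → DetN (leaf d)
  testD : ∀ {f es} → AllPairs _≢_ (map proj₁ (toList es)) →
          All (λ e → DetN (proj₂ e)) (toList es) → DetN (test f es)

IsNondetTree : ∀ {k} → Table k → Tree k → Set
IsNondetTree T Γ =
  All (AttrsIn (attrs T)) (toList Γ) ×
  (∀ r → r ∈ rows T → Any (λ p → r ∈ rows (sub T (proj₁ p))) (paths Γ)) ×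
  (∀ p → p ∈ paths Γ → rows (sub T (proj₁ p)) ≡ [] ⊎ InΠ (proj₂ p) (sub T (proj₁ p)))

IsDetTree : ∀ {k} → Table k → Tree k → Set
IsDetTree T Γ = IsNondetTree T Γ × L⁺.tail Γ ≡ [] × All DetN (toList Γ)

record BoundedComplexityMeasure : Set where
  field
    ψ        : List ℕ → ℕ
    zero⇒λ   : ∀ α → ψ α ≡ 0 → α ≡ []
    λ⇒zero   : ψ [] ≡ 0
    perm     : ∀ α β → α ↭ β → ψ α ≡ ψ β
    mono     : ∀ α β → ψ α ≤ ψ (α ++ β)
    subadd   : ∀ α β → ψ (α ++ β) ≤ ψ α Data.Nat.+ ψ β
    bounded  : ∀ α → length α ≤ ψ α
open BoundedComplexityMeasure public

ψw : ∀ {k} → BoundedComplexityMeasure → Word k → ℕ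
ψw Ψ α = ψ Ψ (map proj₁ α)

ψt : ∀ {k} → BoundedComplexityMeasure → Tree k → ℕ
ψt Ψ Γ = foldr _⊔_ 0 (map (λ p → ψw Ψ (proj₁ p)) (paths Γ))

PsiD : ∀ {k} → BoundedComplexityMeasure → Table k → ℕ → Set
PsiD Ψ T d =
  (rows T ≡ [] × d ≡ 0) ⊎
  (rows T ≢ [] × (∃[ Γ ] (IsDetTree T Γ × ψt Ψ Γ ≡ d)) ×
     (∀ Γ → IsDetTree T Γ → d ≤ ψt Ψ Γ))

PsiA : ∀ {k} → BoundedComplexityMeasure → Table k → ℕ → Set
PsiA Ψ T a =
  (rows T ≡ [] × a ≡ 0) ⊎
  (rows T ≢ [] × (∃[ Γ ] (IsNondetTree T Γ × ψt Ψ Γ ≡ a)) ×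
     (∀ Γ → IsNondetTree T Γ → a ≤ ψt Ψ Γ))

-- Covers (a finite set of words is a duplicate-free list)

IsCover : ∀ {k} → BoundedComplexityMeasure → Table k → ℕ → List (Word k) → Set
IsCover Ψ T n U =
  All (λ α → InΩ T α × ψw Ψ α ≤ n) U ×
  (∀ r → r ∈ rows T → Any (λ α → r ∈ rows (sub T α)) U) ×
  (∀ r α → α ∈ U → r ∈ rows (sub T α) → r ∈ rows T)

IsIrreducibleCover : ∀ {k} → BoundedComplexityMeasure → Table k → ℕ → List (Word k) → Set
IsIrreducibleCover Ψ T n U =
  Unique U × IsCover Ψ T n U ×
  (∀ V → (∀ α → α ∈ V → α ∈ U) → (∃[ α ] (α ∈ U × α ∉ V)) → ¬ IsCover Ψ T n V)

-- Everywhere-definedness of H^∞_{ψ,A} and L_{ψ,A}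
-- (a set of naturals is finite iff it is bounded)

HDefinedEverywhere : ∀ {k} → BoundedComplexityMeasure → (Table k → Set) → Set
HDefinedEverywhere Ψ A =
  ∀ (n : ℕ) → ∃[ B ] (∀ T → A T → ∀ a d → PsiA Ψ T a → a ≤ n → PsiD Ψ T d → d ≤ B)

LDefinedEverywhere : ∀ {k} → BoundedComplexityMeasure → (Table k → Set) → Set
LDefinedEverywhere Ψ A =
  ∀ (n : ℕ) → ∃[ B ] (∀ T → A T → rows T ≢ [] →
    ∀ U → IsIrreducibleCover Ψ T n U → length U ≤ B)

{-# OPTIONS --safe #-}
module Submission where

-- L ⇒ H: the path words of a nondeterministic tree of complexity ≤ n form a (ψ,n)-cover of T;
-- an irreducible subcover V has at most L(n) words, and the complete deterministic tree
-- querying every attribute occurring in V, answering at each leaf with the decision of a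
-- path of the nondeterministic tree consistent with the leaf, solves T with complexity
-- ≤ ψ(attributes of V) ≤ |V|·n by subadditivity.
-- H ⇒ L: relabel every row of T by the set of indices of the words of an irreducible
-- (ψ,n)-cover U it satisfies. The new table T′ lies in A, and the tree with one branch per
-- word of U solves it nondeterministically, so ψ^a(T′) ≤ n and ψ^d(T′) ≤ H(n). By
-- irreducibility each word of U is the only one satisfied by some row, which forces |U|
-- distinct paths in every deterministic tree for T′; such a tree has at most k^ψ^d(T′)
-- paths because ψ bounds the length of words.

open import Defs
open import Data.Bool using (Bool; true; false; T; if_then_else_)
open import Data.Bool.ListAction using (all)
open import Data.Empty using (⊥-elim)
open import Data.Fin using (Fin; toℕ)
import Data.Fin as Fin
import Data.Fin.Properties as Finₚ
open import Data.List
  using ( List; []; _∷_; _++_; map; filter; filterᵇ; foldr; length; lookup; concatMap; allFin; tabulate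
        ; deduplicate)
import Data.List.Properties as Listₚ
open import Data.List.Membership.Propositional using (_∈_; _∉_; find; lose)
open import Data.List.Membership.Propositional.Properties
  using ( ∈-map⁺; ∈-map⁻; ∈-filter⁺; ∈-filter⁻; ∈-lookup; ∈-allFin; ∈-deduplicate⁺; ∈-deduplicate⁻; ∈-++⁺ˡ
        ; ∈-concatMap⁺; ∈-concatMap⁻)
import Data.List.Membership.DecPropositional as DecMembership
import Data.List.Membership.Setoid.Properties as Membershipₛ
open import Data.List.NonEmpty using (List⁺; _∷_; toList)
import Data.List.NonEmpty as List⁺
open import Data.List.Relation.Binary.Subset.Propositional using (_⊆_)
open import Data.List.Relation.Binary.Subset.Propositional.Properties using (Any-resp-⊆)
open import Data.List.Relation.Unary.All as All using (All; []; _∷_)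
import Data.List.Relation.Unary.All.Properties as Allₚ
open import Data.List.Relation.Unary.All.Properties.Core using (¬All⇒Any¬)
open import Data.List.Relation.Unary.AllPairs using (AllPairs; []; _∷_)
open import Data.List.Relation.Unary.Any as Any using (Any; here; there)
import Data.List.Relation.Unary.Any.Properties as Anyₚ
open import Data.List.Relation.Unary.Unique.Propositional using (Unique)
open import Data.List.Relation.Unary.Unique.Propositional.Properties using (allFin⁺)
open import Data.List.Relation.Unary.Unique.DecPropositional.Properties using (deduplicate-!)
open import Data.Maybe using (just; fromMaybe)
import Data.Maybe.Properties as Maybeₚ
import Data.Nat as ℕ
open import Data.Nat
  using (ℕ; zero; suc; _+_; _*_; _^_; _≤_; _<_; _⊔_; _≤?_; _≡ᵇ_; z≤n; s≤s; s≤s⁻¹)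
open import Data.Nat.Induction using (<-rec)
open import Data.Nat.Properties
open import Data.Product using (_×_; _,_; proj₁; proj₂; ∃-syntax)
import Data.Product.Properties as Productₚ
open import Data.Sum using (_⊎_; inj₁; inj₂)
open import Data.Unit using (tt)
open import Effect.Monad using (RawMonad)
open import Function using (_∘_)
open import Level using (0ℓ)
open import Relation.Binary using (Rel; Decidable; DecidableEquality)
open import Relation.Binary.PropositionalEquality
  using (_≡_; _≢_; refl; sym; trans; cong; cong₂; subst; setoid; module ≡-Reasoning)
open import Relation.Nullary using (¬_; ¬?; Dec; yes; no)
open import Relation.Nullary.Decidable using (decidable-stable; T?)
open import Relation.Nullary.Negation using (¬¬-Monad)

private variable
  A : Set
  k : ℕ
  x : A
  xs ys : List A

max-upper : ∀ {m} ms → m ∈ ms → m ≤ foldr _⊔_ 0 ms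
max-upper (m ∷ ms) (here refl) = m≤m⊔n m _
max-upper (m ∷ ms) (there m∈) = ≤-trans (max-upper ms m∈) (m≤n⊔m m _)

max-least : ∀ {b} ms → All (_≤ b) ms → foldr _⊔_ 0 ms ≤ b
max-least [] [] = z≤n
max-least (m ∷ ms) (m≤b ∷ ms≤b) = ⊔-lub m≤b (max-least ms ms≤b)

empty-or-inhabited : (xs : List A) → xs ≡ [] ⊎ ∃[ x ] (x ∈ xs)
empty-or-inhabited [] = inj₁ refl
empty-or-inhabited (x ∷ xs) = inj₂ (x , here refl)

∈⇒≢[] : x ∈ xs → xs ≢ []
∈⇒≢[] x∈ refl = Anyₚ.¬Any[] x∈

≢[]⇒∈ : xs ≢ [] → ∃[ x ] (x ∈ xs)
≢[]⇒∈ {xs = []} xs≢[] = ⊥-elim (xs≢[] refl)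
≢[]⇒∈ {xs = x ∷ xs} _ = x , here refl

Unique⇒lookup-injective : Unique xs → ∀ i j → lookup xs i ≡ lookup xs j → i ≡ j
Unique⇒lookup-injective (x∉ ∷ u) Fin.zero Fin.zero e = refl
Unique⇒lookup-injective (x∉ ∷ u) Fin.zero (Fin.suc j) e = ⊥-elim (All.lookup x∉ (∈-lookup j) e)
Unique⇒lookup-injective (x∉ ∷ u) (Fin.suc i) Fin.zero e = ⊥-elim (All.lookup x∉ (∈-lookup i) (sym e))
Unique⇒lookup-injective (x∉ ∷ u) (Fin.suc i) (Fin.suc j) e = cong Fin.suc (Unique⇒lookup-injective u i j e)

Unique⇒length-≤ : Unique xs → xs ⊆ ys → length xs ≤ length ys
Unique⇒length-≤ {xs = xs} u xs⊆ys = Finₚ.injective⇒≤ position-injective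
  where
  position : Fin (length xs) → Fin _
  position i = Any.index (xs⊆ys (∈-lookup i))
  position-injective : ∀ {i j} → position i ≡ position j → i ≡ j
  position-injective {i} {j} e = Unique⇒lookup-injective u i j
    (Membershipₛ.index-injective (setoid _) (xs⊆ys (∈-lookup i)) (xs⊆ys (∈-lookup j)) e)

Unique⇒length-< : Unique xs → xs ⊆ ys → x ∈ ys → x ∉ xs → length xs < length ys
Unique⇒length-< u xs⊆ys x∈ys x∉xs =
  Unique⇒length-≤ (All.tabulate (λ y∈ e → x∉xs (subst (_∈ _) (sym e) y∈)) ∷ u)
    λ { (here refl) → x∈ys ; (there y∈) → xs⊆ys y∈ }

-- Optimal trees and shortest subcovers exist only classically; the goals they serve are
-- decidable inequalities, so it is enough to know that they are not impossible.

Least : (ℕ → Set) → Set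
Least P = ∃[ m ] (P m × ∀ n → P n → m ≤ n)

¬¬-least : (P : ℕ → Set) → ∀ m → P m → ¬ ¬ Least P
¬¬-least P = <-rec (λ m → P m → ¬ ¬ Least P) step
  where
  step : ∀ m → (∀ {n} → n < m → P n → ¬ ¬ Least P) → P m → ¬ ¬ Least P
  step m below pm noLeast = noLeast (m , pm , minimal)
    where
    minimal : ∀ n → P n → m ≤ n
    minimal n pn with m ≤? n
    ... | yes m≤n = m≤n
    ... | no m≰n = ⊥-elim (below (≰⇒> m≰n) pn noLeast)

¬¬-argmin : (cost : A → ℕ) {P : A → Set} {x : A} → P x →
            ¬ ¬ (∃[ y ] (P y × ∀ z → P z → cost y ≤ cost z))
¬¬-argmin cost {P} {x} px noArgmin =
  ¬¬-least (λ m → ∃[ y ] (P y × cost y ≡ m)) (cost x) (x , px , refl)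
    λ { (_ , (y , py , refl) , least) → noArgmin (y , py , λ z pz → least (cost z) (z , pz , refl)) }

attrsOf : Word k → List ℕ
attrsOf = map proj₁

valuesOf : Word k → List (Fin k)
valuesOf = map proj₂

WordOver : List ℕ → Word k → Set
WordOver as α = All (λ l → proj₁ l ∈ as) α

Sat : List ℕ → List (Fin k) → Word k → Set
Sat as vs α = All (λ l → valueAt as vs (proj₁ l) ≡ just (proj₂ l)) α

satLetter⇒valueAt : ∀ as (vs : List (Fin k)) {f δ} → T (satLetter as vs (f , δ)) →
                    valueAt as vs f ≡ just δ
satLetter⇒valueAt as vs {f} {δ} s with valueAt as vs f
... | just v with v Fin.≟ δ
...   | yes refl = refl

valueAt⇒satLetter : ∀ as (vs : List (Fin k)) {f δ} → valueAt as vs f ≡ just δ →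
                    T (satLetter as vs (f , δ))
valueAt⇒satLetter as vs {f} {δ} e rewrite e with δ Fin.≟ δ
... | yes _ = tt
... | no δ≢δ = δ≢δ refl

all⇒Sat : ∀ as (vs : List (Fin k)) α → T (all (satLetter as vs) α) → Sat as vs α
all⇒Sat as vs α s = All.map (satLetter⇒valueAt as vs) (Allₚ.all⁺ _ α s)

Sat⇒all : ∀ as (vs : List (Fin k)) {α} → Sat as vs α → T (all (satLetter as vs) α)
Sat⇒all as vs s = Allₚ.all⁻ _ (All.map (valueAt⇒satLetter as vs) s)

valueAt-total : ∀ as (vs : List (Fin k)) {f} → length vs ≡ length as → f ∈ as →
                ∃[ δ ] (valueAt as vs f ≡ just δ)
valueAt-total (a ∷ as) (v ∷ vs) {f} e f∈ with a ≡ᵇ f in eq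
... | true = v , refl
... | false with f∈
...   | here refl = ⊥-elim (subst T eq (≡⇒≡ᵇ a a refl))
...   | there f∈as = valueAt-total as vs (suc-injective e) f∈as

-- A word w is also read as the partial row with columns attrsOf w and values valuesOf w,
-- so that Sat (attrsOf w) (valuesOf w) α says that w entails α.
valueAt-word⇒∈ : ∀ (w : Word k) {f δ} → valueAt (attrsOf w) (valuesOf w) f ≡ just δ → (f , δ) ∈ w
valueAt-word⇒∈ ((g , ε) ∷ w) {f} e with g ≡ᵇ f in eq
... | true rewrite ≡ᵇ⇒≡ g f (subst T (sym eq) tt) | Maybeₚ.just-injective e = here refl
... | false = there (valueAt-word⇒∈ w e)

Sat-trans : ∀ {as vs} {w α : Word k} → Sat as vs w → Sat (attrsOf w) (valuesOf w) α → Sat as vs α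
Sat-trans {w = w} sw = All.map (λ e → All.lookup sw (valueAt-word⇒∈ w e))

Sat-restrict : ∀ {as vs} {w α : Word k} → Sat as vs w → Sat as vs α → WordOver (attrsOf w) α →
               Sat (attrsOf w) (valuesOf w) α
Sat-restrict {as = as} {vs} {w} {α} sw sα over = All.zipWith agree (sα , over)
  where
  agree : ∀ {l} → valueAt as vs (proj₁ l) ≡ just (proj₂ l) × proj₁ l ∈ attrsOf w →
          valueAt (attrsOf w) (valuesOf w) (proj₁ l) ≡ just (proj₂ l)
  agree (e , f∈)
    with valueAt-total (attrsOf w) (valuesOf w) (trans (Listₚ.length-map proj₂ w) (sym (Listₚ.length-map proj₁ w))) f∈
  ... | δ , e′ = trans e′ (cong just (Maybeₚ.just-injective
                   (trans (sym (All.lookup sw (valueAt-word⇒∈ w e′))) e)))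

∈-sub⁺ : ∀ (T : Table k) {r} α → r ∈ rows T → Sat (attrs T) (proj₁ r) α → r ∈ rows (sub T α)
∈-sub⁺ T {r} α r∈ s = ∈-filter⁺ _ r∈ (Sat⇒all (attrs T) (proj₁ r) s)

∈-sub⁻ : ∀ (T : Table k) {r} α → r ∈ rows (sub T α) → r ∈ rows T × Sat (attrs T) (proj₁ r) α
∈-sub⁻ T {r} α r∈ with ∈-filter⁻ _ r∈
... | r∈T , s = r∈T , all⇒Sat (attrs T) (proj₁ r) α s

sub-refine : ∀ (T : Table k) w {α} → Sat (attrsOf w) (valuesOf w) α →
             ∀ {r} → r ∈ rows (sub T w) → r ∈ rows (sub T α)
sub-refine T w {α} w⊨α {r} r∈Tw with ∈-sub⁻ T w r∈Tw
... | r∈T , r⊨w = ∈-sub⁺ T α r∈T (Sat-trans {as = attrs T} {vs = proj₁ r} {w = w} r⊨w w⊨α)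

Covers : Table k → List (Word k) → Set
Covers T V = ∀ r → r ∈ rows T → Any (λ α → r ∈ rows (sub T α)) V

pathWords : Tree k → List (Word k)
pathWords Γ = map proj₁ (paths Γ)

pathsEs≡concatMap : ∀ f (es : List (Fin k × Node k)) → pathsEs f es ≡ concatMap (pathsE f) es
pathsEs≡concatMap f [] = refl
pathsEs≡concatMap f (e ∷ es) = cong (pathsE f e ++_) (pathsEs≡concatMap f es)

∈-pathsEs⁻ : ∀ f (es : List (Fin k × Node k)) {p} → p ∈ pathsEs f es → Any ((p ∈_) ∘ pathsE f) es
∈-pathsEs⁻ f es {p} p∈ = ∈-concatMap⁻ (pathsE f) (subst (p ∈_) (pathsEs≡concatMap f es) p∈)

∈-pathsEs⁺ : ∀ f (es : List (Fin k × Node k)) {p} → Any ((p ∈_) ∘ pathsE f) es → p ∈ pathsEs f es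
∈-pathsEs⁺ f es {p} p∈ = subst (p ∈_) (sym (pathsEs≡concatMap f es)) (∈-concatMap⁺ (pathsE f) p∈)

paths-singleton : (N : Node k) → paths (N ∷ []) ≡ pathsN N
paths-singleton N = Listₚ.++-identityʳ (pathsN N)

pathsN-inhabited : (N : Node k) → ∃[ p ] (p ∈ pathsN N)
pathsN-inhabited (leaf d) = _ , here refl
pathsN-inhabited (test f ((δ , N) ∷ es)) with pathsN-inhabited N
... | p , p∈ = _ , ∈-++⁺ˡ (∈-map⁺ (λ p → ((f , δ) ∷ proj₁ p) , proj₂ p) p∈)

mutual
  pathsN-over : ∀ {as} {N : Node k} → AttrsIn as N → All (WordOver as ∘ proj₁) (pathsN N)
  pathsN-over leafA = [] ∷ []
  pathsN-over (testA f∈ oks) = pathsEs-over f∈ oks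

  pathsEs-over : ∀ {as f} {es : List (Fin k × Node k)} → f ∈ as →
                 All (AttrsIn as ∘ proj₂) es → All (WordOver as ∘ proj₁) (pathsEs f es)
  pathsEs-over f∈ [] = []
  pathsEs-over f∈ (ok ∷ oks) =
    Allₚ.++⁺ (Allₚ.map⁺ (All.map (f∈ ∷_) (pathsN-over ok))) (pathsEs-over f∈ oks)

pathWords-over : ∀ {as} {Γ : Tree k} → All (AttrsIn as) (toList Γ) → All (WordOver as) (pathWords Γ)
pathWords-over oks = Allₚ.map⁺ (Allₚ.concat⁺ (Allₚ.map⁺ (All.map pathsN-over oks)))

-- toList labels reduces to allFin (suc k).
labels : List⁺ (Fin (suc k))
labels = Fin.zero ∷ tabulate Fin.suc

mutual
  complete : List ℕ → (Word (suc k) → ℕ) → Node (suc k)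
  complete [] c = leaf (c [])
  complete (f ∷ fs) c = test f (List⁺.map (branch f fs c) labels)

  branch : ℕ → List ℕ → (Word (suc k) → ℕ) → Fin (suc k) → Fin (suc k) × Node (suc k)
  branch f fs c δ = δ , complete fs (λ w → c ((f , δ) ∷ w))

complete-paths⁻ : ∀ fs (c : Word (suc k) → ℕ) {p} → p ∈ pathsN (complete fs c) →
                  attrsOf (proj₁ p) ≡ fs × proj₂ p ≡ c (proj₁ p)
complete-paths⁻ [] c (here refl) = refl , refl
complete-paths⁻ (f ∷ fs) c p∈ with find (∈-pathsEs⁻ f (map (branch f fs c) (allFin _)) p∈)
... | e , e∈ , p∈e with ∈-map⁻ (branch f fs c) e∈
... | δ , _ , refl with ∈-map⁻ (λ p → ((f , δ) ∷ proj₁ p) , proj₂ p) p∈e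
... | q , q∈ , refl with complete-paths⁻ fs (λ w → c ((f , δ) ∷ w)) q∈
... | attrs≡ , dec≡ = cong (f ∷_) attrs≡ , dec≡

complete-paths⁺ : ∀ fs (c : Word (suc k) → ℕ) w → attrsOf w ≡ fs → (w , c w) ∈ pathsN (complete fs c)
complete-paths⁺ [] c [] refl = here refl
complete-paths⁺ (f ∷ fs) c ((f , δ) ∷ w) refl =
  ∈-pathsEs⁺ f (map (branch f fs c) (allFin _)) (Anyₚ.map⁺ (Any.map (λ { refl →
    ∈-map⁺ (λ p → ((f , δ) ∷ proj₁ p) , proj₂ p) (complete-paths⁺ fs _ w refl) }) (∈-allFin δ)))

complete-attrs : ∀ {as} fs (c : Word (suc k) → ℕ) → All (_∈ as) fs → AttrsIn as (complete fs c)
complete-attrs [] c [] = leafA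
complete-attrs (f ∷ fs) c (f∈ ∷ fs⊆) =
  testA f∈ (Allₚ.map⁺ (All.universal (λ _ → complete-attrs fs _ fs⊆) _))

complete-det : ∀ fs (c : Word (suc k) → ℕ) → DetN (complete fs c)
complete-det [] c = leafD
complete-det (f ∷ fs) c =
  testD (subst Unique (trans (sym (Listₚ.map-id (allFin _))) (Listₚ.map-∘ (allFin _))) (allFin⁺ _))
        (Allₚ.map⁺ (All.universal (λ _ → complete-det fs _) _))

distinct-labels⇒length-≤ : ∀ (es : List (Fin (suc k) × Node (suc k))) → Unique (map proj₁ es) →
                           length es ≤ suc k
distinct-labels⇒length-≤ {k} es distinct = begin
  length es                   ≡⟨ Listₚ.length-map proj₁ es ⟨
  length (map proj₁ es)       ≤⟨ Unique⇒length-≤ distinct (λ {δ} _ → ∈-allFin δ) ⟩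
  length (allFin (suc k))     ≡⟨ Listₚ.length-tabulate (λ δ → δ) ⟩
  suc k                       ∎
  where open ≤-Reasoning

mutual
  length-pathsN-≤ : ∀ h {N : Node (suc k)} → DetN N → All (λ p → length (proj₁ p) ≤ h) (pathsN N) →
                    length (pathsN N) ≤ suc k ^ h
  length-pathsN-≤ h leafD _ = m^n>0 _ h
  length-pathsN-≤ zero (testD {f = f} {es = (δ , N) ∷ _} _ _) short with pathsN-inhabited N
  ... | q , q∈ with All.lookup short (∈-++⁺ˡ (∈-map⁺ (λ p → ((f , δ) ∷ proj₁ p) , proj₂ p) q∈))
  ... | ()
  length-pathsN-≤ {k} (suc h) (testD {es = es} distinct dets) short =
    ≤-trans (length-pathsEs-≤ h (toList es) dets short)
            (*-monoˡ-≤ (suc k ^ h) (distinct-labels⇒length-≤ (toList es) distinct))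

  length-pathsEs-≤ : ∀ h {f} (es : List (Fin (suc k) × Node (suc k))) → All (DetN ∘ proj₂) es →
                     All (λ p → length (proj₁ p) ≤ suc h) (pathsEs f es) →
                     length (pathsEs f es) ≤ length es * suc k ^ h
  length-pathsEs-≤ h [] [] _ = z≤n
  length-pathsEs-≤ h {f} ((δ , N) ∷ es) (det ∷ dets) short with Allₚ.++⁻ (pathsE f (δ , N)) short
  ... | shortN , shortEs = begin
    length (pathsE f (δ , N) ++ pathsEs f es)          ≡⟨ Listₚ.length-++ (pathsE f (δ , N)) ⟩
    length (pathsE f (δ , N)) + length (pathsEs f es)  ≡⟨ cong (_+ _) (Listₚ.length-map _ (pathsN N)) ⟩
    length (pathsN N) + length (pathsEs f es)          ≤⟨ +-mono-≤ shorterN (length-pathsEs-≤ h es dets shortEs) ⟩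
    suc _ ^ h + length es * suc _ ^ h                  ∎
    where
    open ≤-Reasoning
    shorterN : length (pathsN N) ≤ suc _ ^ h
    shorterN = length-pathsN-≤ h det (All.map s≤s⁻¹ (Allₚ.map⁻ shortN))

chain : Path k → Node k
chain ([] , d) = leaf d
chain (((f , δ) ∷ α) , d) = test f ((δ , chain (α , d)) ∷ [])

chain-paths : (p : Path k) → pathsN (chain p) ≡ p ∷ []
chain-paths ([] , d) = refl
chain-paths (((f , δ) ∷ α) , d) rewrite chain-paths (α , d) = refl

chain-attrs : ∀ {as} (p : Path k) → WordOver as (proj₁ p) → AttrsIn as (chain p)
chain-attrs ([] , d) [] = leafA
chain-attrs (((f , δ) ∷ α) , d) (f∈ ∷ over) = testA f∈ (chain-attrs (α , d) over ∷ [])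

star : List (Path k) → Tree k
star [] = leaf 0 ∷ []
star (p ∷ ps) = List⁺.map chain (p ∷ ps)

paths-star : (ps : List (Path k)) → ps ≢ [] → paths (star ps) ≡ ps
paths-star [] ps≢[] = ⊥-elim (ps≢[] refl)
paths-star (p ∷ ps) _ = concatMap-chain (p ∷ ps)
  where
  concatMap-chain : ∀ ps → concatMap pathsN (map chain ps) ≡ ps
  concatMap-chain [] = refl
  concatMap-chain (p ∷ ps) rewrite chain-paths p = cong (p ∷_) (concatMap-chain ps)

star-attrs : ∀ {as} (ps : List (Path k)) → ps ≢ [] → All (WordOver as ∘ proj₁) ps →
             All (AttrsIn as) (toList (star ps))
star-attrs [] ps≢[] _ = ⊥-elim (ps≢[] refl)
star-attrs (p ∷ ps) _ overs = Allₚ.map⁺ (All.map (chain-attrs _) overs)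

module _ (Ψ : BoundedComplexityMeasure) where

  ψt-upper : ∀ {Γ : Tree k} {p} → p ∈ paths Γ → ψw Ψ (proj₁ p) ≤ ψt Ψ Γ
  ψt-upper p∈ = max-upper _ (∈-map⁺ (ψw Ψ ∘ proj₁) p∈)

  ψt-least : ∀ {Γ : Tree k} {b} → All (λ p → ψw Ψ (proj₁ p) ≤ b) (paths Γ) → ψt Ψ Γ ≤ b
  ψt-least bs = max-least _ (Allₚ.map⁺ bs)

  ψ-concatMap-≤ : ∀ {n} (V : List (Word k)) → All (λ α → ψw Ψ α ≤ n) V →
                  ψ Ψ (concatMap attrsOf V) ≤ length V * n
  ψ-concatMap-≤ [] [] = ≤-reflexive (λ⇒zero Ψ)
  ψ-concatMap-≤ (α ∷ V) (b ∷ bs) = ≤-trans (subadd Ψ (attrsOf α) _) (+-mono-≤ b (ψ-concatMap-≤ V bs))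

  length-paths-≤ : ∀ {T : Table (suc k)} {Γ} → IsDetTree T Γ → length (paths Γ) ≤ suc k ^ ψt Ψ Γ
  length-paths-≤ {k} {Γ = N ∷ []} (_ , refl , det ∷ []) =
    subst (λ ps → length ps ≤ suc k ^ ψt Ψ (N ∷ [])) (sym (paths-singleton N))
    (length-pathsN-≤ _ det (All.tabulate λ {p} p∈ → begin
      length (proj₁ p)          ≡⟨ Listₚ.length-map proj₁ (proj₁ p) ⟨
      length (attrsOf (proj₁ p)) ≤⟨ bounded Ψ _ ⟩
      ψw Ψ (proj₁ p)            ≤⟨ ψt-upper {Γ = N ∷ []} (subst (p ∈_) (sym (paths-singleton N)) p∈) ⟩
      ψt Ψ (N ∷ [])             ∎))
    where open ≤-Reasoning

-- Determinization

-- The default value is never read: queried attributes are columns (see Sat-readWord).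
readWord : List ℕ → List (Fin (suc k)) → List ℕ → Word (suc k)
readWord as vs = map (λ f → f , fromMaybe Fin.zero (valueAt as vs f))

attrsOf-readWord : ∀ as (vs : List (Fin (suc k))) fs → attrsOf (readWord as vs fs) ≡ fs
attrsOf-readWord as vs fs = trans (sym (Listₚ.map-∘ fs)) (Listₚ.map-id fs)

Sat-readWord : ∀ as (vs : List (Fin (suc k))) {fs} → length vs ≡ length as → All (_∈ as) fs →
               Sat as vs (readWord as vs fs)
Sat-readWord as vs len fs⊆ = Allₚ.map⁺ (All.map read fs⊆)
  where
  read : ∀ {f} → f ∈ as → valueAt as vs f ≡ just (fromMaybe Fin.zero (valueAt as vs f))
  read f∈ with valueAt-total as vs len f∈
  ... | δ , e rewrite e = refl

firstDecision : Word k → List (Path k) → ℕ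
firstDecision w [] = 0
firstDecision w (q ∷ qs) =
  if all (satLetter (attrsOf w) (valuesOf w)) (proj₁ q) then proj₂ q else firstDecision w qs

firstDecision-sound : ∀ (w : Word k) qs → Any (Sat (attrsOf w) (valuesOf w) ∘ proj₁) qs →
                      ∃[ q ] (q ∈ qs × Sat (attrsOf w) (valuesOf w) (proj₁ q) × firstDecision w qs ≡ proj₂ q)
firstDecision-sound w (q ∷ qs) found with all (satLetter (attrsOf w) (valuesOf w)) (proj₁ q) in eq
... | true = q , here refl , all⇒Sat (attrsOf w) (valuesOf w) (proj₁ q) (subst T (sym eq) tt) , refl
... | false with found
...   | here s = ⊥-elim (subst T eq (Sat⇒all (attrsOf w) (valuesOf w) s))
...   | there found′ with firstDecision-sound w qs found′
...     | q′ , q′∈ , s , e = q′ , there q′∈ , s , e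

module Determinization {T : Table (suc k)} {Γ₀ : Tree (suc k)} {V : List (Word (suc k))}
  (wf : WF T) (nondet : IsNondetTree T Γ₀) (V⊆ : V ⊆ pathWords Γ₀) (covers : Covers T V) where

  queried : List ℕ
  queried = concatMap attrsOf V

  decide : Word (suc k) → ℕ
  decide w = firstDecision w (paths Γ₀)

  Γ : Tree (suc k)
  Γ = complete queried decide ∷ []

  Γ-paths⁻ : ∀ {p} → p ∈ paths Γ → attrsOf (proj₁ p) ≡ queried × proj₂ p ≡ decide (proj₁ p)
  Γ-paths⁻ {p} p∈ =
    complete-paths⁻ queried decide (subst (p ∈_) (paths-singleton (complete queried decide)) p∈)

  queried-over : ∀ {α} → α ∈ V → WordOver queried α
  queried-over α∈ = All.tabulate λ l∈ → ∈-concatMap⁺ attrsOf (lose α∈ (∈-map⁺ proj₁ l∈))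

  queried⊆attrs : All (_∈ attrs T) queried
  queried⊆attrs = Allₚ.concat⁺ (Allₚ.map⁺ (All.tabulate λ α∈ →
    Allₚ.map⁺ (All.lookup (pathWords-over (proj₁ nondet)) (V⊆ α∈))))

  leaf-entails : ∀ w {r α} → attrsOf w ≡ queried → α ∈ V → r ∈ rows (sub T w) → r ∈ rows (sub T α) →
                 Sat (attrsOf w) (valuesOf w) α
  leaf-entails w {r} {α} w-queries α∈ r∈Tw r∈Tα =
    Sat-restrict {as = attrs T} {vs = proj₁ r} {w = w} (proj₂ (∈-sub⁻ T w r∈Tw)) (proj₂ (∈-sub⁻ T α r∈Tα))
      (subst (λ as → WordOver as α) (sym w-queries) (queried-over α∈))

  -- w fixes every attribute of V, so a row of T w covered by α ∈ V makes w entail α; hence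
  -- firstDecision finds a path q of Γ₀ with T w ⊆ T q, and T q ≠ [] has the common decision.
  leaf-decision-correct : ∀ w {r} → attrsOf w ≡ queried → r ∈ rows (sub T w) → InΠ (decide w) (sub T w)
  leaf-decision-correct w {r} w-queries r∈Tw with find (covers r (proj₁ (∈-sub⁻ T w r∈Tw)))
  ... | α , α∈ , r∈Tα with ∈-map⁻ proj₁ (V⊆ α∈)
  ... | q₀ , q₀∈ , refl
    with firstDecision-sound w (paths Γ₀) (lose q₀∈ (leaf-entails w w-queries α∈ r∈Tw r∈Tα))
  ... | q , q∈ , w⊨q , decide≡ rewrite decide≡ with proj₂ (proj₂ nondet) q q∈
  ...   | inj₁ Tq≡[] = ⊥-elim (∈⇒≢[] (sub-refine T w w⊨q r∈Tw) Tq≡[])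
  ...   | inj₂ Π-q = All.tabulate λ r′∈ → All.lookup Π-q (sub-refine T w w⊨q r′∈)

  covering : ∀ r → r ∈ rows T → Any (λ p → r ∈ rows (sub T (proj₁ p))) (paths Γ)
  covering r r∈ =
    lose (subst ((w , decide w) ∈_) (sym (paths-singleton (complete queried decide)))
           (complete-paths⁺ queried decide w (attrsOf-readWord (attrs T) (proj₁ r) queried)))
         (∈-sub⁺ T w r∈ (Sat-readWord (attrs T) (proj₁ r) rowLength queried⊆attrs))
    where
    w : Word (suc k)
    w = readWord (attrs T) (proj₁ r) queried
    rowLength : length (proj₁ r) ≡ length (attrs T)
    rowLength = All.lookup (WF.rowsLength wf) r∈

  consistent : ∀ p → p ∈ paths Γ → rows (sub T (proj₁ p)) ≡ [] ⊎ InΠ (proj₂ p) (sub T (proj₁ p))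
  consistent (w , d) p∈ with Γ-paths⁻ p∈ | empty-or-inhabited (rows (sub T w))
  ... | _ , _ | inj₁ Tw≡[] = inj₁ Tw≡[]
  ... | w-queries , refl | inj₂ (r , r∈Tw) = inj₂ (leaf-decision-correct w w-queries r∈Tw)

  isDet : IsDetTree T Γ
  isDet = ((complete-attrs queried decide queried⊆attrs ∷ []) , covering , consistent) , refl ,
          (complete-det queried decide ∷ [])

  ψ-bound : (Ψ : BoundedComplexityMeasure) → ψt Ψ Γ ≤ ψ Ψ queried
  ψ-bound Ψ = ψt-least Ψ {Γ = Γ} (All.tabulate λ p∈ →
    ≤-reflexive (cong (ψ Ψ) (proj₁ (Γ-paths⁻ p∈))))

determinize : ∀ (Ψ : BoundedComplexityMeasure) {T : Table (suc k)} {Γ₀ V} →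
              WF T → IsNondetTree T Γ₀ → V ⊆ pathWords Γ₀ → Covers T V →
              ∃[ Γ ] (IsDetTree T Γ × ψt Ψ Γ ≤ ψ Ψ (concatMap attrsOf V))
determinize Ψ wf nondet V⊆ covers = Γ , isDet , ψ-bound Ψ
  where open Determinization wf nondet V⊆ covers

-- Irreducible covers and L ⇒ H

_≟W_ : DecidableEquality (Word k)
_≟W_ = Listₚ.≡-dec (Productₚ.≡-dec ℕ._≟_ Fin._≟_)

Covers-resp-⊆ : ∀ {T : Table k} {V W} → V ⊆ W → Covers T V → Covers T W
Covers-resp-⊆ V⊆W covV r r∈ = Any-resp-⊆ V⊆W (covV r r∈)

module _ (Ψ : BoundedComplexityMeasure) where

  pathWords-cover : ∀ {T : Table k} {Γ n} → IsNondetTree T Γ → ψt Ψ Γ ≤ n → IsCover Ψ T n (pathWords Γ)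
  pathWords-cover {T = T} {Γ} (attrs-ok , covering , _) ψ≤n =
    All.zip (pathWords-over attrs-ok ,
             Allₚ.map⁺ (All.tabulate λ p∈ → ≤-trans (ψt-upper Ψ {Γ = Γ} p∈) ψ≤n)) ,
    (λ r r∈ → Anyₚ.map⁺ (covering r r∈)) ,
    (λ r α _ r∈ → proj₁ (∈-sub⁻ T α r∈))

  module _ {T : Table k} {n U} (U-cover : IsCover Ψ T n U) where

    private
      U-covers : Covers T U
      U-covers = proj₁ (proj₂ U-cover)

    SubCover : List (Word k) → Set
    SubCover V = Unique V × V ⊆ U × Covers T V

    shortest⇒irreducible : ∀ {V} → SubCover V → (∀ W → SubCover W → length V ≤ length W) →
                           IsIrreducibleCover Ψ T n V
    shortest⇒irreducible {V} (V-unique , V⊆U , V-covers) shortest = V-unique , V-cover , irreducible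
      where
      V-cover : IsCover Ψ T n V
      V-cover = All.tabulate (All.lookup (proj₁ U-cover) ∘ V⊆U) , V-covers ,
                λ r α _ r∈ → proj₁ (∈-sub⁻ T α r∈)
      irreducible : ∀ W → (∀ α → α ∈ W → α ∈ V) → ∃[ α ] (α ∈ V × α ∉ W) → ¬ IsCover Ψ T n W
      irreducible W W⊆V (α , α∈V , α∉W) (_ , W-covers , _) = <⇒≱ shorter (shortest W′ W′-subcover)
        where
        W′ : List (Word k)
        W′ = deduplicate _≟W_ W
        W′⊆V : W′ ⊆ V
        W′⊆V β∈ = W⊆V _ (∈-deduplicate⁻ _≟W_ W β∈)
        W′-subcover : SubCover W′
        W′-subcover = deduplicate-! _≟W_ W , V⊆U ∘ W′⊆V ,
                      Covers-resp-⊆ {T = T} (∈-deduplicate⁺ _≟W_) W-covers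
        shorter : length W′ < length V
        shorter = Unique⇒length-< (deduplicate-! _≟W_ W) W′⊆V α∈V (α∉W ∘ ∈-deduplicate⁻ _≟W_ W)

    ¬¬-irreducible-subcover : ¬ ¬ (∃[ V ] (IsIrreducibleCover Ψ T n V × V ⊆ U))
    ¬¬-irreducible-subcover noSubcover =
      ¬¬-argmin length {P = SubCover} U′-subcover λ { (V , V-subcover@(_ , V⊆U , _) , shortest) →
        noSubcover (V , shortest⇒irreducible V-subcover shortest , V⊆U) }
      where
      U′-subcover : SubCover (deduplicate _≟W_ U)
      U′-subcover = deduplicate-! _≟W_ U , ∈-deduplicate⁻ _≟W_ U ,
                    Covers-resp-⊆ {T = T} (∈-deduplicate⁺ _≟W_) U-covers

L⇒H : ∀ (Ψ : BoundedComplexityMeasure) {A : Table (suc k) → Set} →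
      IsClassOfTables A → LDefinedEverywhere Ψ A → HDefinedEverywhere Ψ A
L⇒H Ψ {A} wf-class L n = B * n , bound
  where
  open RawMonad ¬¬-Monad
  B = proj₁ (L n)
  bound : ∀ T → A T → ∀ a d → PsiA Ψ T a → a ≤ n → PsiD Ψ T d → d ≤ B * n
  bound T AT a d _ _ (inj₁ (_ , refl)) = z≤n
  bound T AT a d (inj₁ (T≡[] , _)) _ (inj₂ (T≢[] , _)) = ⊥-elim (T≢[] T≡[])
  bound T AT a d (inj₂ (_ , (Γ₀ , nondet , refl) , _)) a≤n (inj₂ (T≢[] , _ , d-min)) =
    decidable-stable (d ≤? B * n) do
      (V , V-irreducible@(_ , (V-cover , V-covers , _) , _) , V⊆) ←
        ¬¬-irreducible-subcover Ψ (pathWords-cover Ψ nondet a≤n)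
      let (Γ , det , ψΓ≤) = determinize Ψ (wf-class T AT) nondet V⊆ V-covers
      pure (begin
        d                               ≤⟨ d-min Γ det ⟩
        ψt Ψ Γ                          ≤⟨ ψΓ≤ ⟩
        ψ Ψ (concatMap attrsOf V)       ≤⟨ ψ-concatMap-≤ Ψ V (All.map proj₂ V-cover) ⟩
        length V * n                    ≤⟨ *-monoˡ-≤ n (proj₂ (L n) T AT T≢[] V V-irreducible) ⟩
        B * n                           ∎)
    where open ≤-Reasoning

-- Relabelling by a cover and H ⇒ L

deduplicate-id : ∀ {R : Rel A 0ℓ} (R? : Decidable R) {xs} → AllPairs (λ x y → ¬ R x y) xs →
                 deduplicate R? xs ≡ xs
deduplicate-id R? [] = refl
deduplicate-id R? {x ∷ xs} (x≁ ∷ pairs) = cong (x ∷_) (begin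
  filter (¬? ∘ R? x) (deduplicate R? xs) ≡⟨ cong (filter (¬? ∘ R? x)) (deduplicate-id R? pairs) ⟩
  filter (¬? ∘ R? x) xs                  ≡⟨ Listₚ.filter-all (¬? ∘ R? x) x≁ ⟩
  xs                                     ∎)
  where open ≡-Reasoning

keepCols-[] : ∀ as (vs : List (Fin k)) → length vs ≡ length as → keepCols [] as vs ≡ vs
keepCols-[] [] [] _ = refl
keepCols-[] (a ∷ as) (v ∷ vs) e = cong (v ∷_) (keepCols-[] as vs (suc-injective e))

I-[] : ∀ {T : Table k} → WF T → I [] T ≡ T
I-[] {T = T} wf = cong₂ mkTable (Listₚ.filter-all _ (All.universal (λ _ → tt) (attrs T)))
  (trans (cong (deduplicate _) (Listₚ.map-id-local keeps)) (deduplicate-id _ (WF.rowsDistinct wf)))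
  where
  keeps : All (λ r → (keepCols [] (attrs T) (proj₁ r) , proj₂ r) ≡ r) (rows T)
  keeps = All.map (λ len → cong (_, _) (keepCols-[] (attrs T) _ len)) (WF.rowsLength wf)

_≟R_ : DecidableEquality (Row k)
_≟R_ = Productₚ.≡-dec (Listₚ.≡-dec Fin._≟_) (Listₚ.≡-dec ℕ._≟_)

defaultTo : ℕ → List ℕ → List ℕ
defaultTo d [] = d ∷ []
defaultTo d (x ∷ xs) = x ∷ xs

defaultTo-≢[] : ∀ d xs → defaultTo d xs ≢ []
defaultTo-≢[] d [] ()
defaultTo-≢[] d (x ∷ xs) ()

∈-defaultTo⁺ : ∀ {d y} xs → y ∈ xs → y ∈ defaultTo d xs
∈-defaultTo⁺ (x ∷ xs) y∈ = y∈

∈-defaultTo⁻ : ∀ {d y} xs → y ∈ defaultTo d xs → y ∈ xs ⊎ xs ≡ []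
∈-defaultTo⁻ [] _ = inj₂ refl
∈-defaultTo⁻ (x ∷ xs) y∈ = inj₁ y∈

module Relabelling {T : Table (suc k)} (U : List (Word (suc k))) where

  hit : List (Fin (suc k)) → Fin (length U) → Bool
  hit vs j = all (satLetter (attrs T) vs) (lookup U j)

  hits : List (Fin (suc k)) → List (Fin (length U))
  hits vs = filterᵇ (hit vs) (allFin (length U))

  ∈-hits⁺ : ∀ {vs} j → Sat (attrs T) vs (lookup U j) → j ∈ hits vs
  ∈-hits⁺ {vs} j s = ∈-filter⁺ (T? ∘ hit vs) (∈-allFin j) (Sat⇒all (attrs T) vs s)

  ∈-hits⁻ : ∀ {vs j} → j ∈ hits vs → Sat (attrs T) vs (lookup U j)
  ∈-hits⁻ {vs} {j} j∈ = all⇒Sat (attrs T) vs (lookup U j) (proj₂ (∈-filter⁻ (T? ∘ hit vs) {xs = allFin _} j∈))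

  -- A row gets as decisions the indices of the words of U it satisfies; the default {0} only
  -- serves value tuples satisfying no word, which do not occur in T when U covers it.
  ν : List (Fin (suc k)) → List ℕ
  ν vs = defaultTo 0 (map toℕ (hits vs))

  relabel : Row (suc k) → Row (suc k)
  relabel r = proj₁ r , ν (proj₁ r)

  T′ : Table (suc k)
  T′ = J ν T

  ∈-ν⁺ : ∀ {vs} j → Sat (attrs T) vs (lookup U j) → toℕ j ∈ ν vs
  ∈-ν⁺ {vs} j s = ∈-defaultTo⁺ (map toℕ (hits vs)) (∈-map⁺ toℕ (∈-hits⁺ j s))

  ∈-ν⁻ : ∀ {vs x} j → Sat (attrs T) vs (lookup U j) → x ∈ ν vs →
         ∃[ i ] (x ≡ toℕ i × Sat (attrs T) vs (lookup U i))
  ∈-ν⁻ {vs} j s x∈ with ∈-defaultTo⁻ (map toℕ (hits vs)) x∈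
  ... | inj₂ none = ⊥-elim (∈⇒≢[] (∈-map⁺ toℕ (∈-hits⁺ j s)) none)
  ... | inj₁ x∈ with ∈-map⁻ toℕ x∈
  ...   | i , i∈ , refl = i , refl , ∈-hits⁻ i∈

  relabel-∈-sub⁺ : ∀ α {r} → r ∈ rows (sub T α) → relabel r ∈ rows (sub T′ α)
  relabel-∈-sub⁺ α r∈ with ∈-sub⁻ T α r∈
  ... | r∈T , r⊨α = ∈-sub⁺ T′ α (∈-map⁺ relabel r∈T) r⊨α

  relabel-∈-sub⁻ : ∀ α {r′} → r′ ∈ rows (sub T′ α) → ∃[ r ] (r ∈ rows (sub T α) × r′ ≡ relabel r)
  relabel-∈-sub⁻ α r′∈ with ∈-sub⁻ T′ α r′∈
  ... | r′∈T′ , r′⊨α with ∈-map⁻ relabel r′∈T′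
  ... | r , r∈T , refl = r , ∈-sub⁺ T α r∈T r′⊨α , refl

  module Star (Ψ : BoundedComplexityMeasure) {n} (U-cover : IsCover Ψ T n U) (T≢[] : rows T ≢ []) where

    U-word : ∀ j → InΩ T (lookup U j) × ψw Ψ (lookup U j) ≤ n
    U-word j = All.lookup (proj₁ U-cover) (∈-lookup j)

    U-covers-T′ : Covers T′ U
    U-covers-T′ r′ r′∈ with ∈-map⁻ relabel r′∈
    ... | r , r∈ , refl = Any.map (λ {α} → relabel-∈-sub⁺ α) (proj₁ (proj₂ U-cover) r r∈)

    starPaths : List (Path (suc k))
    starPaths = map (λ j → lookup U j , toℕ j) (allFin (length U))

    ∈-starPaths⁺ : ∀ {α} (α∈ : α ∈ U) → (α , toℕ (Any.index α∈)) ∈ starPaths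
    ∈-starPaths⁺ α∈ = subst (λ β → (β , toℕ (Any.index α∈)) ∈ starPaths) (sym (Anyₚ.lookup-index α∈))
                        (∈-map⁺ (λ j → lookup U j , toℕ j) (∈-allFin (Any.index α∈)))

    starPaths≢[] : starPaths ≢ []
    starPaths≢[] with ≢[]⇒∈ T≢[]
    ... | r , r∈ with find (proj₁ (proj₂ U-cover) r r∈)
    ... | α , α∈ , _ = ∈⇒≢[] (∈-starPaths⁺ α∈)

    Γ⋆ : Tree (suc k)
    Γ⋆ = star starPaths

    paths-Γ⋆ : paths Γ⋆ ≡ starPaths
    paths-Γ⋆ = paths-star starPaths starPaths≢[]

    U⊆pathWords : U ⊆ pathWords Γ⋆
    U⊆pathWords α∈ = subst (_ ∈_) (cong (map proj₁) (sym paths-Γ⋆)) (∈-map⁺ proj₁ (∈-starPaths⁺ α∈))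

    Γ⋆-nondet : IsNondetTree T′ Γ⋆
    Γ⋆-nondet = star-attrs starPaths starPaths≢[] (Allₚ.map⁺ (All.universal (proj₁ ∘ U-word) _)) ,
                covering , consistent
      where
      covering : ∀ r′ → r′ ∈ rows T′ → Any (λ p → r′ ∈ rows (sub T′ (proj₁ p))) (paths Γ⋆)
      covering r′ r′∈ with find (U-covers-T′ r′ r′∈)
      ... | α , α∈ , r′∈T′α = subst (Any _) (sym paths-Γ⋆) (lose (∈-starPaths⁺ α∈) r′∈T′α)
      consistent : ∀ p → p ∈ paths Γ⋆ → rows (sub T′ (proj₁ p)) ≡ [] ⊎ InΠ (proj₂ p) (sub T′ (proj₁ p))
      consistent p p∈ with ∈-map⁻ (λ j → lookup U j , toℕ j) (subst (p ∈_) paths-Γ⋆ p∈)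
      ... | j , _ , refl = inj₂ (All.tabulate λ r′∈ → decision (relabel-∈-sub⁻ (lookup U j) r′∈))
        where
        decision : ∀ {r′} → ∃[ r ] (r ∈ rows (sub T (lookup U j)) × r′ ≡ relabel r) → toℕ j ∈ proj₂ r′
        decision (r , r∈ , refl) = ∈-ν⁺ j (proj₂ (∈-sub⁻ T (lookup U j) r∈))

    Γ⋆-ψ≤n : ψt Ψ Γ⋆ ≤ n
    Γ⋆-ψ≤n = ψt-least Ψ {Γ = Γ⋆} (subst (All _) (sym paths-Γ⋆) (Allₚ.map⁺ (All.universal (proj₂ ∘ U-word) _)))

  Isolates : Fin (length U) → Row (suc k) → Set
  Isolates j r = r ∈ rows (sub T (lookup U j)) ×
                 ∀ {β} → β ∈ U → r ∈ rows (sub T β) → β ≡ lookup U j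

  module Separation (Ψ : BoundedComplexityMeasure) {n} (U-irreducible : IsIrreducibleCover Ψ T n U) where
    open DecMembership (_≟R_ {suc k}) using (_∈?_)

    U-covers : Covers T U
    U-covers = proj₁ (proj₂ (proj₁ (proj₂ U-irreducible)))

    isolated-row : ∀ j → ∃[ r ] (Isolates j r)
    isolated-row j
      with find (¬All⇒Any¬ covered? (rows T) λ all → others-not-cover λ r r∈ → All.lookup all r∈)
      where
      others : List (Word (suc k))
      others = filter (¬? ∘ (_≟W lookup U j)) U
      others⊆U : others ⊆ U
      others⊆U β∈ = proj₁ (∈-filter⁻ (¬? ∘ (_≟W lookup U j)) β∈)
      covered? : ∀ r → Dec (Any (λ β → r ∈ rows (sub T β)) others)
      covered? r = Any.any? (λ β → r ∈? rows (sub T β)) others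
      others-not-cover : ¬ Covers T others
      others-not-cover covers = proj₂ (proj₂ U-irreducible) others (λ _ → others⊆U)
        (lookup U j , ∈-lookup j , λ αⱼ∈ → proj₂ (∈-filter⁻ (¬? ∘ (_≟W lookup U j)) {xs = U} αⱼ∈) refl)
        (All.tabulate (All.lookup (proj₁ (proj₁ (proj₂ U-irreducible))) ∘ others⊆U) , covers ,
         λ r β _ r∈ → proj₁ (∈-sub⁻ T β r∈))
    ... | r , r∈T , uncovered with find (U-covers r r∈T)
    ...   | β , β∈ , r∈Tβ = r , subst (λ γ → r ∈ rows (sub T γ)) (only-αⱼ β∈ r∈Tβ) r∈Tβ , only-αⱼ
      where
      only-αⱼ : ∀ {β} → β ∈ U → r ∈ rows (sub T β) → β ≡ lookup U j
      only-αⱼ {β} β∈ r∈Tβ with β ≟W lookup U j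
      ... | yes β≡αⱼ = β≡αⱼ
      ... | no β≢αⱼ = ⊥-elim (uncovered (lose (∈-filter⁺ (¬? ∘ (_≟W lookup U j)) β∈ β≢αⱼ) r∈Tβ))

    isolated-decision : ∀ j {r p} → Isolates j r → relabel r ∈ rows (sub T′ (proj₁ p)) →
                        rows (sub T′ (proj₁ p)) ≡ [] ⊎ InΠ (proj₂ p) (sub T′ (proj₁ p)) →
                        proj₂ p ≡ toℕ j
    isolated-decision j _ r∈T′p (inj₁ empty) = ⊥-elim (∈⇒≢[] r∈T′p empty)
    isolated-decision j (r∈Tαⱼ , only-αⱼ) r∈T′p (inj₂ Π)
      with ∈-sub⁻ T (lookup U j) r∈Tαⱼ
    ... | r∈T , r⊨αⱼ with ∈-ν⁻ j r⊨αⱼ (All.lookup Π r∈T′p)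
    ... | i , e , r⊨αᵢ = trans e (cong toℕ (Unique⇒lookup-injective (proj₁ U-irreducible) i j
                           (only-αⱼ (∈-lookup i) (∈-sub⁺ T (lookup U i) r∈T r⊨αᵢ))))

    -- Isolated rows force the decisions 0, …, |U| - 1 onto pairwise different paths.
    length-cover-≤-length-paths : ∀ {Γ} → IsDetTree T′ Γ → length U ≤ length (paths Γ)
    length-cover-≤-length-paths {Γ} ((_ , covering , consistent) , _) = Finₚ.injective⇒≤ pathOf-injective
      where
      reaches : ∀ j → Any (λ p → relabel (proj₁ (isolated-row j)) ∈ rows (sub T′ (proj₁ p))) (paths Γ)
      reaches j = covering _ (∈-map⁺ relabel (proj₁ (∈-sub⁻ T (lookup U j) (proj₁ (proj₂ (isolated-row j))))))
      pathOf : Fin (length U) → Fin (length (paths Γ))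
      pathOf j = Any.index (reaches j)
      decision-pathOf : ∀ j → proj₂ (lookup (paths Γ) (pathOf j)) ≡ toℕ j
      decision-pathOf j = isolated-decision j {p = lookup (paths Γ) (pathOf j)} (proj₂ (isolated-row j))
                            (Anyₚ.lookup-index (reaches j)) (consistent _ (∈-lookup (pathOf j)))
      pathOf-injective : ∀ {i j} → pathOf i ≡ pathOf j → i ≡ j
      pathOf-injective {i} {j} e = Finₚ.toℕ-injective
        (trans (sym (decision-pathOf i)) (trans (cong (proj₂ ∘ lookup (paths Γ)) e) (decision-pathOf j)))

H⇒L : ∀ (Ψ : BoundedComplexityMeasure) {A : Table (suc k) → Set} →
      IsClassOfTables A → Closed A → HDefinedEverywhere Ψ A → LDefinedEverywhere Ψ A
H⇒L {k} Ψ {A} wf-class closed H n = suc k ^ B , bound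
  where
  open RawMonad ¬¬-Monad
  B : ℕ
  B = proj₁ (H n)
  bound : ∀ T → A T → rows T ≢ [] → ∀ U → IsIrreducibleCover Ψ T n U → length U ≤ suc k ^ B
  bound T AT T≢[] U U-irreducible = decidable-stable (length U ≤? suc k ^ B) do
      (Γa , nondet-a , a-min) ← ¬¬-argmin (ψt Ψ) Γ⋆-nondet
      (Γd , det-d , d-min) ← ¬¬-argmin (ψt Ψ) Γ⋆-determinized
      let d≤B = proj₂ (H n) T′ AT′ _ _ (inj₂ (T′≢[] , (Γa , nondet-a , refl) , a-min))
                  (≤-trans (a-min Γ⋆ Γ⋆-nondet) Γ⋆-ψ≤n) (inj₂ (T′≢[] , (Γd , det-d , refl) , d-min))
      pure (begin
        length U            ≤⟨ length-cover-≤-length-paths det-d ⟩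
        length (paths Γd)   ≤⟨ length-paths-≤ Ψ det-d ⟩
        suc k ^ ψt Ψ Γd     ≤⟨ ^-monoʳ-≤ (suc k) d≤B ⟩
        suc k ^ B           ∎)
    where
    open ≤-Reasoning
    open Relabelling {T = T} U
    open Star Ψ (proj₁ (proj₂ U-irreducible)) T≢[]
    open Separation Ψ U-irreducible
    AT′ : A T′
    AT′ = proj₁ (closed T′)
      (T , AT , [] , [] , ν , (λ vs → defaultTo-≢[] 0 _) , cong (J ν) (sym (I-[] (wf-class T AT))))
    wf′ : WF T′
    wf′ = wf-class T′ AT′
    T′≢[] : rows T′ ≢ []
    T′≢[] = ∈⇒≢[] (∈-map⁺ relabel (proj₂ (≢[]⇒∈ T≢[])))
    Γ⋆-determinized : IsDetTree T′ (proj₁ (determinize Ψ wf′ Γ⋆-nondet U⊆pathWords U-covers-T′))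
    Γ⋆-determinized = proj₁ (proj₂ (determinize Ψ wf′ Γ⋆-nondet U⊆pathWords U-covers-T′))

theorem1 : (k : ℕ) → 2 ≤ k → (Ψ : BoundedComplexityMeasure) → (A : Table k → Set) →
           IsClassOfTables A → Closed A → Nontrivial A →
           (HDefinedEverywhere Ψ A → LDefinedEverywhere Ψ A) ×
           (LDefinedEverywhere Ψ A → HDefinedEverywhere Ψ A)
theorem1 (suc k) (s≤s _) Ψ A wf-class closed _ = H⇒L Ψ wf-class closed , L⇒H Ψ wf-class
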